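{- For all nonnegative integers $n,k$, $$\binom{n}{k}_F\equiv\begin{cases}0 & \text{if } n\equiv 0 \pmod 3 \text{ and } k\equiv 1\pmod 3,\\[4pt] \dbinom{\lceil 2n/3\rceil}{\lceil 2k/3\rceil} & \text{if } n\equiv 1\pmod 3 \text{ and } k\equiv 0\pmod 3,\\[8pt] \dbinom{\lfloor 2n/3\rfloor}{\lfloor 2k/3\rfloor} & \text{otherwise,}\end{cases}\pmod 2,$$ where $\lceil\cdot\rceil$ and $\lfloor\cdot\rfloor$ denote the ceiling and floor functions and the right-hand binomial coefficients are ordinary binomial coefficients.
   Context: The Fibonacci numbers are defined by $F_0=0$, $F_1=1$, $F_n=F_{n-1}+F_{n-2}$ for $n\ge 2$. The Fibotorial is $n!_F=F_1F_2\cdots F_n$ (with $0!_F=1$), and the Fibonomial coefficient is $\binom{n}{k}_F=\frac{n!_F}{k!_F\,(n-k)!_F}$ for $0\le k\le n$, with $\binom{n}{k}_F=0$ for $k<0$ or $k>n$. Ordinary binomial coefficients $\binom{a}{b}$ are likewise $0$ when $b<0$ or $b>a$. -}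

module Defs where

open import Data.Nat using (ℕ; zero; suc; _+_; _*_; _∸_; _≤?_; NonZero; >-nonZero; _<_; s≤s; z≤n)
open import Data.Nat.Properties using (*-mono-<; ≤-trans; +-monoˡ-<; m≤m+n)
open import Data.Nat.DivMod using (_/_)
open import Relation.Nullary using (yes; no)

fib : ℕ → ℕ
fib zero = 0
fib (suc zero) = 1
fib (suc (suc n)) = fib (suc n) + fib n

fibtorial : ℕ → ℕ
fibtorial zero = 1
fibtorial (suc n) = fibtorial n * fib (suc n)

fib-suc-pos : ∀ n → 0 < fib (suc n)
fib-suc-pos zero = s≤s z≤n
fib-suc-pos (suc n) = ≤-trans (fib-suc-pos n) (m≤m+n (fib (suc n)) (fib n))

fibtorial-pos : ∀ n → 0 < fibtorial n
fibtorial-pos zero = s≤s z≤n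
fibtorial-pos (suc n) = *-mono-< (fibtorial-pos n) (fib-suc-pos n)

fibtorial-prod-nonZero : ∀ k m → NonZero (fibtorial k * fibtorial m)
fibtorial-prod-nonZero k m = >-nonZero (*-mono-< (fibtorial-pos k) (fibtorial-pos m))

fibonomial : ℕ → ℕ → ℕ
fibonomial n k with k ≤? n
... | yes _ = (fibtorial n / (fibtorial k * fibtorial (n ∸ k))) {{fibtorial-prod-nonZero k (n ∸ k)}}
... | no _ = 0

module Submission where

-- C(k+m, k)_F obeys a Pascal-type recurrence with Fibonacci coefficients, and F_j is even
-- exactly when 3 ∣ j, so modulo 2 only the terms with index j ≢ 0 (mod 3) survive.  Writing
-- k = s + 3b and m = t + 3c, the claimed right-hand side is, for each pair of digits (s, t),
-- an explicit ordinary binomial in 2(b + c) and 2b; these satisfy the same parity recurrence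
-- by Pascal's rule and have the same initial values.  For k > n both sides vanish.

open import Defs
open import Data.Nat using (ℕ; zero; suc; z≤n; _+_; _*_; _∸_; _%_; _/_; _≤_; _<_; _≤?_; s≤s; NonZero; parity)
open import Data.Nat.Properties
open import Data.Nat.DivMod using (+-distrib-/-∣ʳ; m*n/n≡m; /-congˡ; /-congʳ; /-monoˡ-≤; [m+kn]%n≡m%n)
open import Data.Nat.Divisibility using (divides)
open import Data.Nat.Combinatorics using (_C_; nCn≡1; nCk+nC[k+1]≡[n+1]C[k+1]; k>n⇒nCk≡0)
open import Data.Nat.Tactic.RingSolver using (solve-∀)
open import Data.Fin using (Fin; toℕ)
open import Data.Fin.Patterns using (0F; 1F; 2F)
open import Data.Parity.Base as ℙ using (Parity; 0ℙ; 1ℙ)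
import Data.Parity.Properties as ℙₚ
open import Data.Product using (_×_; _,_)
open import Data.Sum using (inj₁; inj₂)
open import Relation.Binary.PropositionalEquality
open import Relation.Nullary using (¬_; yes; no; contradiction)

fib-+ : ∀ m n → fib (suc (m + n)) ≡ fib (suc m) * fib (suc n) + fib m * fib n
fib-+ zero n = sym (trans (+-identityʳ _) (+-identityʳ _))
fib-+ (suc zero) n = sym (cong₂ _+_ (+-identityʳ (fib (suc n))) (+-identityʳ (fib n)))
fib-+ (suc (suc m)) n = begin
    fib (suc (suc m + n)) + fib (suc m + n)
  ≡⟨ cong₂ _+_ (fib-+ (suc m) n) (fib-+ m n) ⟩
    (a * fib (suc n) + b * fib n) + (b * fib (suc n) + c * fib n)
  ≡⟨ regroup a b c (fib (suc n)) (fib n) ⟩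
    (a + b) * fib (suc n) + (b + c) * fib n
  ∎
  where
  open ≡-Reasoning
  a b c : ℕ
  a = fib (suc (suc m))
  b = fib (suc m)
  c = fib m
  regroup : ∀ a b c x y → (a * x + b * y) + (b * x + c * y) ≡ (a + b) * x + (b + c) * y
  regroup = solve-∀

-- The Pascal-type recurrence comes from F(k+m+2) = F(m+2) F(k+1) + F(k) F(m+1).
fibonomial′ : ℕ → ℕ → ℕ
fibonomial′ zero m = 1
fibonomial′ (suc k) zero = 1
fibonomial′ (suc k) (suc m) = fib (2 + m) * fibonomial′ k (suc m) + fib k * fibonomial′ (suc k) m

fibonomial′-fibtorial : ∀ k m → fibonomial′ k m * (fibtorial k * fibtorial m) ≡ fibtorial (k + m)
fibonomial′-fibtorial zero m = trans (+-identityʳ _) (+-identityʳ _)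
fibonomial′-fibtorial (suc k) zero = begin
    1 * (fibtorial (suc k) * 1) ≡⟨ trans (*-identityˡ _) (*-identityʳ _) ⟩
    fibtorial (suc k)           ≡⟨ cong fibtorial (sym (+-identityʳ (suc k))) ⟩
    fibtorial (suc k + zero)    ∎
  where open ≡-Reasoning
fibonomial′-fibtorial (suc k) (suc m) = begin
    (fib (2 + m) * h₁ + fib k * h₂) * (fibtorial k * fib (suc k) * (fibtorial m * fib (suc m)))
  ≡⟨ regroup (fib (2 + m)) (fib k) h₁ h₂ (fibtorial k) (fibtorial m) (fib (suc k)) (fib (suc m)) ⟩
    fib (2 + m) * fib (suc k) * (h₁ * (fibtorial k * fibtorial (suc m)))
      + fib k * fib (suc m) * (h₂ * (fibtorial (suc k) * fibtorial m))
  ≡⟨ cong₂ (λ u v → fib (2 + m) * fib (suc k) * u + fib k * fib (suc m) * v)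
       (fibonomial′-fibtorial k (suc m))
       (trans (fibonomial′-fibtorial (suc k) m) (cong fibtorial (sym (+-suc k m)))) ⟩
    fib (2 + m) * fib (suc k) * X + fib k * fib (suc m) * X
  ≡⟨ factor (fib (2 + m)) (fib (suc k)) (fib k) (fib (suc m)) X ⟩
    X * (fib (2 + m) * fib (suc k) + fib (suc m) * fib k)
  ≡⟨ cong (X *_) (sym (fib-+ (suc m) k)) ⟩
    X * fib (suc (suc m + k))
  ≡⟨ cong (λ z → X * fib (suc z)) (+-comm (suc m) k) ⟩
    fibtorial (suc k + suc m)
  ∎
  where
  open ≡-Reasoning
  h₁ h₂ X : ℕ
  h₁ = fibonomial′ k (suc m)
  h₂ = fibonomial′ (suc k) m
  X = fibtorial (k + suc m)
  regroup : ∀ r s h₁ h₂ A B p q →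
    (r * h₁ + s * h₂) * (A * p * (B * q)) ≡ r * p * (h₁ * (A * (B * q))) + s * q * (h₂ * (A * p * B))
  regroup = solve-∀
  factor : ∀ r p s q X → r * p * X + s * q * X ≡ X * (r * p + q * s)
  factor = solve-∀

fibonomial-+ : ∀ k m → fibonomial (k + m) k ≡ fibonomial′ k m
fibonomial-+ k m with k ≤? k + m
... | no k≰k+m = contradiction (m≤m+n k m) k≰k+m
... | yes _ = begin
    (fibtorial (k + m) / (fibtorial k * fibtorial (k + m ∸ k))) {{fibtorial-prod-nonZero k (k + m ∸ k)}}
  ≡⟨ /-congʳ {{fibtorial-prod-nonZero k (k + m ∸ k)}} {{fibtorial-prod-nonZero k m}}
       (cong (λ z → fibtorial k * fibtorial z) (m+n∸m≡n k m)) ⟩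
    (fibtorial (k + m) / (fibtorial k * fibtorial m)) {{fibtorial-prod-nonZero k m}}
  ≡⟨ /-congˡ {{fibtorial-prod-nonZero k m}} (sym (fibonomial′-fibtorial k m)) ⟩
    (fibonomial′ k m * (fibtorial k * fibtorial m) / (fibtorial k * fibtorial m)) {{fibtorial-prod-nonZero k m}}
  ≡⟨ m*n/n≡m (fibonomial′ k m) (fibtorial k * fibtorial m) {{fibtorial-prod-nonZero k m}} ⟩
    fibonomial′ k m
  ∎
  where open ≡-Reasoning

fibonomial-> : ∀ {n k} → n < k → fibonomial n k ≡ 0
fibonomial-> {n} {k} n<k with k ≤? n
... | yes k≤n = contradiction n<k (≤⇒≯ k≤n)
... | no _ = refl

parity⇒%2 : ∀ m n → parity m ≡ parity n → m % 2 ≡ n % 2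
parity⇒%2 m n eq = trans (%2≡ m) (trans (cong toℕℙ eq) (sym (%2≡ n)))
  where
  toℕℙ : Parity → ℕ
  toℕℙ 0ℙ = 0
  toℕℙ 1ℙ = 1
  %2≡ : ∀ n → n % 2 ≡ toℕℙ (parity n)
  %2≡ 0 = refl
  %2≡ 1 = refl
  %2≡ (suc (suc n)) = %2≡ n

parity-pascal : ∀ n k → parity (suc n C suc k) ≡ parity (n C k) ℙ.+ parity (n C suc k)
parity-pascal n k = trans (cong parity (sym (nCk+nC[k+1]≡[n+1]C[k+1] n k))) (ℙₚ.+-homo-+ (n C k) (n C suc k))

parity-fibonomial′-suc : ∀ k m → parity (fibonomial′ (suc k) (suc m)) ≡
  (parity (fib (2 + m)) ℙ.* parity (fibonomial′ k (suc m))) ℙ.+ (parity (fib k) ℙ.* parity (fibonomial′ (suc k) m))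
parity-fibonomial′-suc k m = begin
    parity (fib (2 + m) * fibonomial′ k (suc m) + fib k * fibonomial′ (suc k) m)
  ≡⟨ ℙₚ.+-homo-+ (fib (2 + m) * fibonomial′ k (suc m)) (fib k * fibonomial′ (suc k) m) ⟩
    parity (fib (2 + m) * fibonomial′ k (suc m)) ℙ.+ parity (fib k * fibonomial′ (suc k) m)
  ≡⟨ cong₂ ℙ._+_ (ℙₚ.*-homo-* (fib (2 + m)) _) (ℙₚ.*-homo-* (fib k) _) ⟩
    (parity (fib (2 + m)) ℙ.* parity (fibonomial′ k (suc m))) ℙ.+ (parity (fib k) ℙ.* parity (fibonomial′ (suc k) m))
  ∎
  where open ≡-Reasoning

Digits : Set
Digits = Fin 3 × ℕ

value : Digits → ℕ
value (r , q) = toℕ r + q * 3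

suc-digits : Digits → Digits
suc-digits (0F , q) = 1F , q
suc-digits (1F , q) = 2F , q
suc-digits (2F , q) = 0F , suc q

digits : ℕ → Digits
digits zero = 0F , 0
digits (suc n) = suc-digits (digits n)

value-suc-digits : ∀ d → value (suc-digits d) ≡ suc (value d)
value-suc-digits (0F , q) = refl
value-suc-digits (1F , q) = refl
value-suc-digits (2F , q) = refl

value-digits : ∀ n → value (digits n) ≡ n
value-digits zero = refl
value-digits (suc n) = trans (value-suc-digits (digits n)) (cong suc (value-digits n))

fibParityᵈ : Digits → Parity
fibParityᵈ (r , _) = parity (fib (toℕ r))

parity-fib : ∀ n → parity (fib n) ≡ fibParityᵈ (digits n)
parity-fib 0 = refl
parity-fib 1 = refl
parity-fib 2 = refl
parity-fib (suc (suc (suc n))) = begin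
    parity ((fib (suc n) + fib n) + fib (suc n))
  ≡⟨ ℙₚ.+-homo-+ (fib (suc n) + fib n) (fib (suc n)) ⟩
    parity (fib (suc n) + fib n) ℙ.+ parity (fib (suc n))
  ≡⟨ cong (ℙ._+ parity (fib (suc n))) (ℙₚ.+-homo-+ (fib (suc n)) (fib n)) ⟩
    (parity (fib (suc n)) ℙ.+ parity (fib n)) ℙ.+ parity (fib (suc n))
  ≡⟨ cancel (parity (fib (suc n))) (parity (fib n)) ⟩
    parity (fib n)
  ≡⟨ parity-fib n ⟩
    fibParityᵈ (digits n)
  ≡⟨ sym (fibParityᵈ-suc-digits³ (digits n)) ⟩
    fibParityᵈ (digits (3 + n))
  ∎
  where
  open ≡-Reasoning
  cancel : ∀ p q → (p ℙ.+ q) ℙ.+ p ≡ q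
  cancel 0ℙ q = ℙₚ.+-identityʳ q
  cancel 1ℙ 0ℙ = refl
  cancel 1ℙ 1ℙ = refl
  fibParityᵈ-suc-digits³ : ∀ d → fibParityᵈ (suc-digits (suc-digits (suc-digits d))) ≡ fibParityᵈ d
  fibParityᵈ-suc-digits³ (0F , q) = refl
  fibParityᵈ-suc-digits³ (1F , q) = refl
  fibParityᵈ-suc-digits³ (2F , q) = refl

-- binomialᵈ (s , b) (t , c) is the right-hand side of the theorem for k = s + 3b, n = k + t + 3c;
-- doubling is written x * 2 so that digit carries (suc b) * 2 compute to 2 + b * 2.
binomialᵈ : Digits → Digits → ℕ
binomialᵈ (0F , b) (0F , c) = ((b + c) * 2) C (b * 2)
binomialᵈ (0F , b) (1F , c) = (1 + (b + c) * 2) C (b * 2)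
binomialᵈ (0F , b) (2F , c) = (1 + (b + c) * 2) C (b * 2)
binomialᵈ (1F , b) (0F , c) = ((b + c) * 2) C (b * 2)
binomialᵈ (1F , b) (1F , c) = (1 + (b + c) * 2) C (b * 2)
binomialᵈ (1F , b) (2F , c) = 0
binomialᵈ (2F , b) (0F , c) = (1 + (b + c) * 2) C (1 + b * 2)
binomialᵈ (2F , b) (1F , c) = (2 + (b + c) * 2) C (1 + b * 2)
binomialᵈ (2F , b) (2F , c) = (2 + (b + c) * 2) C (1 + b * 2)

binomialᵈ-zeroˡ : ∀ e → binomialᵈ (0F , 0) e ≡ 1
binomialᵈ-zeroˡ (0F , c) = refl
binomialᵈ-zeroˡ (1F , c) = refl
binomialᵈ-zeroˡ (2F , c) = refl

binomialᵈ-zeroʳ : ∀ d → binomialᵈ d (0F , 0) ≡ 1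
binomialᵈ-zeroʳ (0F , b) = trans (cong (λ x → (x * 2) C (b * 2)) (+-identityʳ b)) (nCn≡1 (b * 2))
binomialᵈ-zeroʳ (1F , b) = trans (cong (λ x → (x * 2) C (b * 2)) (+-identityʳ b)) (nCn≡1 (b * 2))
binomialᵈ-zeroʳ (2F , b) = trans (cong (λ x → (1 + x * 2) C (1 + b * 2)) (+-identityʳ b)) (nCn≡1 (1 + b * 2))

-- Pascal's rule where both Fibonacci coefficients are odd; in the other cases the sides coincide.
parity-binomialᵈ-suc : ∀ d e → parity (binomialᵈ (suc-digits d) (suc-digits e)) ≡
  (fibParityᵈ (suc-digits (suc-digits e)) ℙ.* parity (binomialᵈ d (suc-digits e)))
    ℙ.+ (fibParityᵈ d ℙ.* parity (binomialᵈ (suc-digits d) e))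
parity-binomialᵈ-suc (0F , b) (0F , c) = sym (ℙₚ.+-identityʳ _)
parity-binomialᵈ-suc (0F , b) (1F , c) = refl
parity-binomialᵈ-suc (0F , b) (2F , c) = sym (ℙₚ.+-identityʳ _)
parity-binomialᵈ-suc (1F , b) (0F , c) = parity-pascal (1 + (b + c) * 2) (b * 2)
parity-binomialᵈ-suc (1F , b) (1F , c) = refl
parity-binomialᵈ-suc (1F , b) (2F , c) rewrite +-suc b c = parity-pascal (2 + (b + c) * 2) (b * 2)
parity-binomialᵈ-suc (2F , b) (0F , c) = parity-pascal (2 + (b + c) * 2) (1 + b * 2)
parity-binomialᵈ-suc (2F , b) (1F , c) = refl
parity-binomialᵈ-suc (2F , b) (2F , c) rewrite +-suc b c = parity-pascal (3 + (b + c) * 2) (1 + b * 2)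

parity-fibonomial′ : ∀ k m → parity (fibonomial′ k m) ≡ parity (binomialᵈ (digits k) (digits m))
parity-fibonomial′ zero m = cong parity (sym (binomialᵈ-zeroˡ (digits m)))
parity-fibonomial′ (suc k) zero = cong parity (sym (binomialᵈ-zeroʳ (digits (suc k))))
parity-fibonomial′ (suc k) (suc m) = begin
    parity (fibonomial′ (suc k) (suc m))
  ≡⟨ parity-fibonomial′-suc k m ⟩
    (parity (fib (2 + m)) ℙ.* parity (fibonomial′ k (suc m))) ℙ.+ (parity (fib k) ℙ.* parity (fibonomial′ (suc k) m))
  ≡⟨ cong₂ ℙ._+_ (cong₂ ℙ._*_ (parity-fib (2 + m)) (parity-fibonomial′ k (suc m)))
                 (cong₂ ℙ._*_ (parity-fib k) (parity-fibonomial′ (suc k) m)) ⟩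
    (fibParityᵈ (digits (2 + m)) ℙ.* parity (binomialᵈ (digits k) (digits (suc m))))
      ℙ.+ (fibParityᵈ (digits k) ℙ.* parity (binomialᵈ (digits (suc k)) (digits m)))
  ≡⟨ sym (parity-binomialᵈ-suc (digits k) (digits m)) ⟩
    parity (binomialᵈ (digits (suc k)) (digits (suc m)))
  ∎
  where open ≡-Reasoning

-- The right-hand side of the theorem, with n % 3 and k % 3 passed as the first two arguments.
binomialByResidue : ℕ → ℕ → ℕ → ℕ → ℕ
binomialByResidue 0 1 n k = 0
binomialByResidue 1 0 n k = ((2 * n + 2) / 3) C ((2 * k + 2) / 3)
binomialByResidue _ _ n k = ((2 * n) / 3) C ((2 * k) / 3)

[m+kn]/n≡m/n+k : ∀ m k n .{{_ : NonZero n}} → (m + k * n) / n ≡ m / n + k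
[m+kn]/n≡m/n+k m k n = trans (+-distrib-/-∣ʳ m (divides k refl)) (cong (m / n +_) (m*n/n≡m k n))

[2[r+x*3]]/3≡[2r]/3+x*2 : ∀ r x → (2 * (r + x * 3)) / 3 ≡ (2 * r) / 3 + x * 2
[2[r+x*3]]/3≡[2r]/3+x*2 r x = trans (cong (_/ 3) (regroup r x)) ([m+kn]/n≡m/n+k (2 * r) (x * 2) 3)
  where
  regroup : ∀ r x → 2 * (r + x * 3) ≡ 2 * r + x * 2 * 3
  regroup = solve-∀

[2[r+x*3]+2]/3≡[2r+2]/3+x*2 : ∀ r x → (2 * (r + x * 3) + 2) / 3 ≡ (2 * r + 2) / 3 + x * 2
[2[r+x*3]+2]/3≡[2r+2]/3+x*2 r x = trans (cong (_/ 3) (regroup r x)) ([m+kn]/n≡m/n+k (2 * r + 2) (x * 2) 3)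
  where
  regroup : ∀ r x → 2 * (r + x * 3) + 2 ≡ 2 * r + 2 + x * 2 * 3
  regroup = solve-∀

binomialᵈ≡binomialByResidue : ∀ d e →
  binomialᵈ d e ≡ binomialByResidue ((value d + value e) % 3) (value d % 3) (value d + value e) (value d)
binomialᵈ≡binomialByResidue (s , b) (t , c) = begin
    binomialᵈ (s , b) (t , c)
  ≡⟨ byCases s t ⟩
    binomialByResidue (r % 3) (toℕ s % 3) (r + (b + c) * 3) k
  ≡⟨ cong₂ (λ u v → binomialByResidue u v (r + (b + c) * 3) k)
       (sym ([m+kn]%n≡m%n r (b + c) 3)) (sym ([m+kn]%n≡m%n (toℕ s) b 3)) ⟩
    binomialByResidue ((r + (b + c) * 3) % 3) (k % 3) (r + (b + c) * 3) k
  ≡⟨ cong (λ n → binomialByResidue (n % 3) (k % 3) n k) (regroup (toℕ s) (toℕ t) b c) ⟩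
    binomialByResidue ((k + value (t , c)) % 3) (k % 3) (k + value (t , c)) k
  ∎
  where
  open ≡-Reasoning
  r k : ℕ
  r = toℕ s + toℕ t
  k = toℕ s + b * 3
  regroup : ∀ s t b c → (s + t) + (b + c) * 3 ≡ (s + b * 3) + (t + c * 3)
  regroup = solve-∀
  floor : ∀ r q → ((2 * (r + (b + c) * 3)) / 3) C ((2 * (q + b * 3)) / 3)
                ≡ ((2 * r) / 3 + (b + c) * 2) C ((2 * q) / 3 + b * 2)
  floor r q = cong₂ _C_ ([2[r+x*3]]/3≡[2r]/3+x*2 r (b + c)) ([2[r+x*3]]/3≡[2r]/3+x*2 q b)
  ceil : ∀ r q → ((2 * (r + (b + c) * 3) + 2) / 3) C ((2 * (q + b * 3) + 2) / 3)
               ≡ ((2 * r + 2) / 3 + (b + c) * 2) C ((2 * q + 2) / 3 + b * 2)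
  ceil r q = cong₂ _C_ ([2[r+x*3]+2]/3≡[2r+2]/3+x*2 r (b + c)) ([2[r+x*3]+2]/3≡[2r+2]/3+x*2 q b)
  byCases : ∀ s′ t′ → binomialᵈ (s′ , b) (t′ , c) ≡
    binomialByResidue ((toℕ s′ + toℕ t′) % 3) (toℕ s′ % 3) ((toℕ s′ + toℕ t′) + (b + c) * 3) (toℕ s′ + b * 3)
  byCases 0F 0F = sym (floor 0 0)
  byCases 0F 1F = sym (ceil 1 0)
  byCases 0F 2F = sym (floor 2 0)
  byCases 1F 0F = sym (floor 1 1)
  byCases 1F 1F = sym (floor 2 1)
  byCases 1F 2F = refl
  byCases 2F 0F = sym (floor 2 2)
  byCases 2F 1F = sym (floor 3 2)
  byCases 2F 2F = sym (floor 4 2)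

binomialByResidue-otherwise : ∀ a b n k → ¬ (a ≡ 0 × b ≡ 1) → ¬ (a ≡ 1 × b ≡ 0) →
  binomialByResidue a b n k ≡ ((2 * n) / 3) C ((2 * k) / 3)
binomialByResidue-otherwise 0 0 n k _ _ = refl
binomialByResidue-otherwise 0 1 n k ¬01 _ = contradiction (refl , refl) ¬01
binomialByResidue-otherwise 0 (suc (suc b)) n k _ _ = refl
binomialByResidue-otherwise 1 0 n k _ ¬10 = contradiction (refl , refl) ¬10
binomialByResidue-otherwise 1 (suc b) n k _ _ = refl
binomialByResidue-otherwise (suc (suc a)) b n k _ _ = refl

binomialByResidue-vanishes : ∀ a b n k → (2 * n) / 3 < (2 * k) / 3 → (2 * n + 2) / 3 < (2 * k + 2) / 3 →
  binomialByResidue a b n k ≡ 0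
binomialByResidue-vanishes 0 0 n k floor< _ = k>n⇒nCk≡0 floor<
binomialByResidue-vanishes 0 1 n k _ _ = refl
binomialByResidue-vanishes 0 (suc (suc b)) n k floor< _ = k>n⇒nCk≡0 floor<
binomialByResidue-vanishes 1 0 n k _ ceil< = k>n⇒nCk≡0 ceil<
binomialByResidue-vanishes 1 (suc b) n k floor< _ = k>n⇒nCk≡0 floor<
binomialByResidue-vanishes (suc (suc a)) b n k floor< _ = k>n⇒nCk≡0 floor<

m+n≤o⇒m/n<o/n : ∀ {m n o} .{{_ : NonZero n}} → m + n ≤ o → m / n < o / n
m+n≤o⇒m/n<o/n {m} {n} {o} m+n≤o = begin-strict
    m / n            <⟨ m<m+n (m / n) (s≤s z≤n) ⟩
    m / n + 1        ≡⟨ sym ([m+kn]/n≡m/n+k m 1 n) ⟩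
    (m + 1 * n) / n  ≤⟨ /-monoˡ-≤ n (subst (λ x → m + x ≤ o) (sym (*-identityˡ n)) m+n≤o) ⟩
    o / n            ∎
  where open ≤-Reasoning

-- The floor and ceiling binomials need not vanish at k = n + 1, so this case is settled digit by digit.
binomialByResidue-suc : ∀ n → binomialByResidue (n % 3) (suc n % 3) n (suc n) ≡ 0
binomialByResidue-suc n =
  subst₂ (λ n n′ → binomialByResidue (n % 3) (n′ % 3) n n′ ≡ 0) (value-digits n) (value-digits (suc n))
    (byDigits (digits n))
  where
  open ≡-Reasoning
  byDigits : ∀ d → binomialByResidue (value d % 3) (value (suc-digits d) % 3) (value d) (value (suc-digits d)) ≡ 0
  byDigits (0F , q) = cong₂ (λ u v → binomialByResidue u v (q * 3) (1 + q * 3))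
    ([m+kn]%n≡m%n 0 q 3) ([m+kn]%n≡m%n 1 q 3)
  byDigits (1F , q) = begin
      binomialByResidue ((1 + q * 3) % 3) ((2 + q * 3) % 3) (1 + q * 3) (2 + q * 3)
    ≡⟨ cong₂ (λ u v → binomialByResidue u v (1 + q * 3) (2 + q * 3)) ([m+kn]%n≡m%n 1 q 3) ([m+kn]%n≡m%n 2 q 3) ⟩
      ((2 * (1 + q * 3)) / 3) C ((2 * (2 + q * 3)) / 3)
    ≡⟨ cong₂ _C_ ([2[r+x*3]]/3≡[2r]/3+x*2 1 q) ([2[r+x*3]]/3≡[2r]/3+x*2 2 q) ⟩
      (q * 2) C (1 + q * 2)
    ≡⟨ k>n⇒nCk≡0 (n<1+n (q * 2)) ⟩
      0
    ∎
  byDigits (2F , q) = begin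
      binomialByResidue ((2 + q * 3) % 3) ((0 + suc q * 3) % 3) (2 + q * 3) (0 + suc q * 3)
    ≡⟨ cong₂ (λ u v → binomialByResidue u v (2 + q * 3) (0 + suc q * 3))
         ([m+kn]%n≡m%n 2 q 3) ([m+kn]%n≡m%n 0 (suc q) 3) ⟩
      ((2 * (2 + q * 3)) / 3) C ((2 * (0 + suc q * 3)) / 3)
    ≡⟨ cong₂ _C_ ([2[r+x*3]]/3≡[2r]/3+x*2 2 q) ([2[r+x*3]]/3≡[2r]/3+x*2 0 (suc q)) ⟩
      (1 + q * 2) C (2 + q * 2)
    ≡⟨ k>n⇒nCk≡0 (n<1+n (1 + q * 2)) ⟩
      0
    ∎

binomialByResidue-> : ∀ {n k} → n < k → binomialByResidue (n % 3) (k % 3) n k ≡ 0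
binomialByResidue-> {n} {suc k} (s≤s n≤k) with m≤n⇒m<n∨m≡n n≤k
... | inj₂ refl = binomialByResidue-suc n
... | inj₁ n<k = binomialByResidue-vanishes (n % 3) (suc k % 3) n (suc k) (m+n≤o⇒m/n<o/n floor-gap) (m+n≤o⇒m/n<o/n ceil-gap)
  where
  double-gap : 2 * n + 4 ≤ 2 * suc k
  double-gap = subst (_≤ 2 * suc k) (double-+ n) (*-monoʳ-≤ 2 (s≤s n<k))
    where
    double-+ : ∀ n → 2 * (2 + n) ≡ 2 * n + 4
    double-+ = solve-∀
  floor-gap : 2 * n + 3 ≤ 2 * suc k
  floor-gap = ≤-trans (+-monoʳ-≤ (2 * n) (n≤1+n 3)) double-gap
  ceil-gap : 2 * n + 2 + 3 ≤ 2 * suc k + 2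
  ceil-gap = subst (_≤ 2 * suc k + 2) (trans (+-assoc (2 * n) 3 2) (sym (+-assoc (2 * n) 2 3))) (+-monoˡ-≤ 2 floor-gap)

fibonomial-+-mod-2 : ∀ k m → fibonomial (k + m) k % 2 ≡ binomialByResidue ((k + m) % 3) (k % 3) (k + m) k % 2
fibonomial-+-mod-2 k m =
  parity⇒%2 (fibonomial (k + m) k) (binomialByResidue ((k + m) % 3) (k % 3) (k + m) k) (begin
    parity (fibonomial (k + m) k)
  ≡⟨ cong parity (fibonomial-+ k m) ⟩
    parity (fibonomial′ k m)
  ≡⟨ parity-fibonomial′ k m ⟩
    parity (binomialᵈ (digits k) (digits m))
  ≡⟨ cong parity binomialᵈ-digits ⟩
    parity (binomialByResidue ((k + m) % 3) (k % 3) (k + m) k)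
  ∎)
  where
  open ≡-Reasoning
  binomialᵈ-digits : binomialᵈ (digits k) (digits m) ≡ binomialByResidue ((k + m) % 3) (k % 3) (k + m) k
  binomialᵈ-digits =
    subst₂ (λ k′ m′ → binomialᵈ (digits k) (digits m) ≡ binomialByResidue ((k′ + m′) % 3) (k′ % 3) (k′ + m′) k′)
      (value-digits k) (value-digits m) (binomialᵈ≡binomialByResidue (digits k) (digits m))

fibonomial-mod-2 : ∀ n k → fibonomial n k % 2 ≡ binomialByResidue (n % 3) (k % 3) n k % 2
fibonomial-mod-2 n k with ≤-<-connex k n
... | inj₁ k≤n = subst (λ n → fibonomial n k % 2 ≡ binomialByResidue (n % 3) (k % 3) n k % 2)
                  (m+[n∸m]≡n k≤n) (fibonomial-+-mod-2 k (n ∸ k))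
... | inj₂ n<k = cong (_% 2) (trans (fibonomial-> n<k) (sym (binomialByResidue-> n<k)))

lemma2p4 : (n k : ℕ) →
    (n % 3 ≡ 0 → k % 3 ≡ 1 → fibonomial n k % 2 ≡ 0)
    × (n % 3 ≡ 1 → k % 3 ≡ 0 →
        fibonomial n k % 2 ≡ (((2 * n + 2) / 3) C ((2 * k + 2) / 3)) % 2)
    × (¬ (n % 3 ≡ 0 × k % 3 ≡ 1) → ¬ (n % 3 ≡ 1 × k % 3 ≡ 0) →
        fibonomial n k % 2 ≡ (((2 * n) / 3) C ((2 * k) / 3)) % 2)
lemma2p4 n k =
    (λ n≡0 k≡1 → trans congruence (cong₂ (λ a b → binomialByResidue a b n k % 2) n≡0 k≡1))
  , (λ n≡1 k≡0 → trans congruence (cong₂ (λ a b → binomialByResidue a b n k % 2) n≡1 k≡0))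
  , (λ ¬01 ¬10 → trans congruence (cong (_% 2) (binomialByResidue-otherwise (n % 3) (k % 3) n k ¬01 ¬10)))
  where
  congruence : fibonomial n k % 2 ≡ binomialByResidue (n % 3) (k % 3) n k % 2
  congruence = fibonomial-mod-2 n k
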